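{- Let $P,Q\in\mathbb{Z}[x]$ and let $\mathcal{L},\mathcal{M}\subset\mathbb{Z}$ be finite sets. If $\mathbb{Z}[x]=\mathcal{L}[x]+(P)$ and $\mathbb{Z}[x]=\mathcal{M}[x]+(Q)$, then there exists a finite set $\mathcal{N}\subset\mathbb{Z}$ such that $\mathbb{Z}[x]=\mathcal{N}[x]+(PQ)$.
   Context: For a finite set $\mathcal{N}\subset\mathbb{Z}$, $\mathcal{N}[x]:=\{d_0+d_1x+\dots+d_kx^k : k\ge 0,\ d_j\in\mathcal{N}\}$ denotes the set of polynomials all of whose coefficients lie in $\mathcal{N}$. For $P\in\mathbb{Z}[x]$, $(P)$ denotes the principal ideal of $\mathbb{Z}[x]$ generated by $P$, and $\mathcal{N}[x]+(P)=\{R+S : R\in\mathcal{N}[x], S\in(P)\}$. -}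

module Defs where

open import Data.Integer using (ℤ; 0ℤ; _+_; _*_)
open import Data.List using (List; []; _∷_)
open import Data.List.Membership.Propositional using (_∈_)
open import Data.List.Relation.Unary.All using (All)
open import Data.Empty using (⊥)
open import Data.Nat using (ℕ; zero; suc)
open import Data.Product using (Σ; ∃; _×_)
open import Relation.Binary.PropositionalEquality using (_≡_)

-- A polynomial in ℤ[x] is represented by its coefficient list
-- [a₀ , a₁ , … , aₖ] (lowest degree first).  Two lists represent the same
-- polynomial iff all their coefficients agree (trailing zeros are irrelevant).
Poly : Set
Poly = List ℤ

coeff : Poly → ℕ → ℤ
coeff []       _       = 0ℤ
coeff (a ∷ p)  zero    = a
coeff (a ∷ p)  (suc i) = coeff p i

_≈ₚ_ : Poly → Poly → Set
p ≈ₚ q = ∀ i → coeff p i ≡ coeff q i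

_+ₚ_ : Poly → Poly → Poly
[]      +ₚ q       = q
(a ∷ p) +ₚ []      = a ∷ p
(a ∷ p) +ₚ (b ∷ q) = (a + b) ∷ (p +ₚ q)

_·ₚ_ : ℤ → Poly → Poly
c ·ₚ []      = []
c ·ₚ (a ∷ p) = (c * a) ∷ (c ·ₚ p)

-- multiplication: (a + x p) q = a q + x (p q)
_*ₚ_ : Poly → Poly → Poly
[]      *ₚ q = []
(a ∷ p) *ₚ q = (a ·ₚ q) +ₚ (0ℤ ∷ (p *ₚ q))

-- Finite subsets of ℤ are given by lists of their elements.
-- R ∈ 𝒩[x]: R = d₀ + d₁ x + … + dₖ xᵏ with k ≥ 0 and all dⱼ ∈ 𝒩,
-- i.e. R is (represented by) a nonempty digit list with all digits in 𝒩.
InDigitPoly : List ℤ → Poly → Set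
InDigitPoly 𝒩 []      = ⊥
InDigitPoly 𝒩 (d ∷ ds) = All (_∈ 𝒩) (d ∷ ds)

InSumIdeal : List ℤ → Poly → Poly → Set
InSumIdeal 𝒩 P F = Σ Poly λ R → Σ Poly λ T → InDigitPoly 𝒩 R × (F ≈ₚ (R +ₚ (P *ₚ T)))

Covers : List ℤ → Poly → Set
Covers 𝒩 P = ∀ (F : Poly) → InSumIdeal 𝒩 P F

{-# OPTIONS --safe #-}
-- Write F = R₁ + P T₁ with R₁ ∈ 𝓛[x] and then T₁ = R₂ + Q T with R₂ ∈ 𝓜[x].
-- Substituting, F = (R₁ + P R₂) + P Q T.  Every coefficient of P R₂ is a sum of
-- at most deg P + 1 terms pⱼ m with m ∈ 𝓜, so the coefficients of R₁ + P R₂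
-- range over a finite set built from 𝓛, 𝓜 and the coefficients of P alone.
module Submission where

open import Defs
open import Data.Integer using (ℤ; 0ℤ; _+_; _*_)
open import Data.Integer.Properties
  using (+-assoc; +-comm; *-assoc; *-zeroˡ; *-zeroʳ; +-identityˡ; +-identityʳ; *-distribˡ-+; *-distribʳ-+)
open import Data.List using (List; []; _∷_; map; _++_; cartesianProductWith)
open import Data.List.Membership.Propositional using (_∈_)
open import Data.List.Membership.Propositional.Properties
  using (∈-map⁺; ∈-++⁺ˡ; ∈-++⁺ʳ; ∈-cartesianProductWith⁺)
open import Data.List.Relation.Unary.All as All using (All; []; _∷_)
open import Data.List.Relation.Unary.Any using (here; there)
open import Data.Nat using (zero; suc)
open import Data.Product using (Σ; _,_)
open import Relation.Binary.Bundles using (Setoid)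
import Relation.Binary.Reasoning.Setoid
open import Relation.Binary.PropositionalEquality using (_≡_; refl; sym; trans; cong; cong₂; module ≡-Reasoning)

+ₚ-identityʳ : ∀ p → (p +ₚ []) ≡ p
+ₚ-identityʳ []      = refl
+ₚ-identityʳ (a ∷ p) = refl

+ₚ-assoc : ∀ p q r → ((p +ₚ q) +ₚ r) ≡ (p +ₚ (q +ₚ r))
+ₚ-assoc []      q       r       = refl
+ₚ-assoc (a ∷ p) []      r       = refl
+ₚ-assoc (a ∷ p) (b ∷ q) []      = refl
+ₚ-assoc (a ∷ p) (b ∷ q) (c ∷ r) = cong₂ _∷_ (+-assoc a b c) (+ₚ-assoc p q r)

+ₚ-comm : ∀ p q → (p +ₚ q) ≡ (q +ₚ p)
+ₚ-comm []      q       = sym (+ₚ-identityʳ q)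
+ₚ-comm (a ∷ p) []      = refl
+ₚ-comm (a ∷ p) (b ∷ q) = cong₂ _∷_ (+-comm a b) (+ₚ-comm p q)

+ₚ-interchange : ∀ p q r s → ((p +ₚ q) +ₚ (r +ₚ s)) ≡ ((p +ₚ r) +ₚ (q +ₚ s))
+ₚ-interchange p q r s = begin
  (p +ₚ q) +ₚ (r +ₚ s)   ≡⟨ +ₚ-assoc p q (r +ₚ s) ⟩
  p +ₚ (q +ₚ (r +ₚ s))   ≡⟨ cong (p +ₚ_) (+ₚ-assoc q r s) ⟨
  p +ₚ ((q +ₚ r) +ₚ s)   ≡⟨ cong (λ t → p +ₚ (t +ₚ s)) (+ₚ-comm q r) ⟩
  p +ₚ ((r +ₚ q) +ₚ s)   ≡⟨ cong (p +ₚ_) (+ₚ-assoc r q s) ⟩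
  p +ₚ (r +ₚ (q +ₚ s))   ≡⟨ +ₚ-assoc p r (q +ₚ s) ⟨
  (p +ₚ r) +ₚ (q +ₚ s)   ∎
  where open ≡-Reasoning

·ₚ-assoc : ∀ a b p → ((a * b) ·ₚ p) ≡ (a ·ₚ (b ·ₚ p))
·ₚ-assoc a b []      = refl
·ₚ-assoc a b (c ∷ p) = cong₂ _∷_ (*-assoc a b c) (·ₚ-assoc a b p)

·ₚ-distribˡ : ∀ c p q → (c ·ₚ (p +ₚ q)) ≡ ((c ·ₚ p) +ₚ (c ·ₚ q))
·ₚ-distribˡ c []      q       = refl
·ₚ-distribˡ c (a ∷ p) []      = refl
·ₚ-distribˡ c (a ∷ p) (b ∷ q) = cong₂ _∷_ (*-distribˡ-+ c a b) (·ₚ-distribˡ c p q)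

·ₚ-distribʳ : ∀ a b p → ((a + b) ·ₚ p) ≡ ((a ·ₚ p) +ₚ (b ·ₚ p))
·ₚ-distribʳ a b []      = refl
·ₚ-distribʳ a b (c ∷ p) = cong₂ _∷_ (*-distribʳ-+ c a b) (·ₚ-distribʳ a b p)

-- In the inductive steps below, (0 ∷ s) +ₚ (0 ∷ t) reduces to 0 ∷ (s +ₚ t),
-- since 0ℤ + 0ℤ computes to 0ℤ.
*ₚ-distribˡ : ∀ p q r → (p *ₚ (q +ₚ r)) ≡ ((p *ₚ q) +ₚ (p *ₚ r))
*ₚ-distribˡ []      q r = refl
*ₚ-distribˡ (a ∷ p) q r = begin
  (a ·ₚ (q +ₚ r)) +ₚ (0ℤ ∷ (p *ₚ (q +ₚ r)))
    ≡⟨ cong₂ (λ s t → s +ₚ (0ℤ ∷ t)) (·ₚ-distribˡ a q r) (*ₚ-distribˡ p q r) ⟩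
  ((a ·ₚ q) +ₚ (a ·ₚ r)) +ₚ ((0ℤ ∷ (p *ₚ q)) +ₚ (0ℤ ∷ (p *ₚ r)))
    ≡⟨ +ₚ-interchange (a ·ₚ q) (a ·ₚ r) (0ℤ ∷ (p *ₚ q)) (0ℤ ∷ (p *ₚ r)) ⟩
  ((a ∷ p) *ₚ q) +ₚ ((a ∷ p) *ₚ r) ∎
  where open ≡-Reasoning

*ₚ-distribʳ : ∀ p q r → ((p +ₚ q) *ₚ r) ≡ ((p *ₚ r) +ₚ (q *ₚ r))
*ₚ-distribʳ []      q       r = refl
*ₚ-distribʳ (a ∷ p) []      r = sym (+ₚ-identityʳ ((a ∷ p) *ₚ r))
*ₚ-distribʳ (a ∷ p) (b ∷ q) r = begin
  ((a + b) ·ₚ r) +ₚ (0ℤ ∷ ((p +ₚ q) *ₚ r))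
    ≡⟨ cong₂ (λ s t → s +ₚ (0ℤ ∷ t)) (·ₚ-distribʳ a b r) (*ₚ-distribʳ p q r) ⟩
  ((a ·ₚ r) +ₚ (b ·ₚ r)) +ₚ ((0ℤ ∷ (p *ₚ r)) +ₚ (0ℤ ∷ (q *ₚ r)))
    ≡⟨ +ₚ-interchange (a ·ₚ r) (b ·ₚ r) (0ℤ ∷ (p *ₚ r)) (0ℤ ∷ (q *ₚ r)) ⟩
  ((a ∷ p) *ₚ r) +ₚ ((b ∷ q) *ₚ r) ∎
  where open ≡-Reasoning

·ₚ-*ₚ-assoc : ∀ c p q → ((c ·ₚ p) *ₚ q) ≡ (c ·ₚ (p *ₚ q))
·ₚ-*ₚ-assoc c []      q = refl
·ₚ-*ₚ-assoc c (a ∷ p) q = begin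
  ((c * a) ·ₚ q) +ₚ (0ℤ ∷ ((c ·ₚ p) *ₚ q))
    ≡⟨ cong₂ (λ s t → s +ₚ (0ℤ ∷ t)) (·ₚ-assoc c a q) (·ₚ-*ₚ-assoc c p q) ⟩
  (c ·ₚ (a ·ₚ q)) +ₚ (0ℤ ∷ (c ·ₚ (p *ₚ q)))
    ≡⟨ cong (λ z → (c ·ₚ (a ·ₚ q)) +ₚ (z ∷ (c ·ₚ (p *ₚ q)))) (*-zeroʳ c) ⟨
  (c ·ₚ (a ·ₚ q)) +ₚ (c ·ₚ (0ℤ ∷ (p *ₚ q)))
    ≡⟨ ·ₚ-distribˡ c (a ·ₚ q) (0ℤ ∷ (p *ₚ q)) ⟨
  c ·ₚ ((a ∷ p) *ₚ q) ∎
  where open ≡-Reasoning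

coeff-+ₚ : ∀ p q i → coeff (p +ₚ q) i ≡ coeff p i + coeff q i
coeff-+ₚ []      q       i       = sym (+-identityˡ (coeff q i))
coeff-+ₚ (a ∷ p) []      i       = sym (+-identityʳ (coeff (a ∷ p) i))
coeff-+ₚ (a ∷ p) (b ∷ q) zero    = refl
coeff-+ₚ (a ∷ p) (b ∷ q) (suc i) = coeff-+ₚ p q i

coeff-·ₚ : ∀ c p i → coeff (c ·ₚ p) i ≡ c * coeff p i
coeff-·ₚ c []      i       = sym (*-zeroʳ c)
coeff-·ₚ c (a ∷ p) zero    = refl
coeff-·ₚ c (a ∷ p) (suc i) = coeff-·ₚ c p i

-- _≈ₚ_ wrapped in a record so that the two polynomials can be inferred from a proof.
record _≋_ (p q : Poly) : Set where
  constructor mk≋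
  field coeff-≡ : p ≈ₚ q
open _≋_

≋-setoid : Setoid _ _
≋-setoid = record
  { Carrier       = Poly
  ; _≈_           = _≋_
  ; isEquivalence = record
    { refl  = mk≋ λ i → refl
    ; sym   = λ e → mk≋ λ i → sym (coeff-≡ e i)
    ; trans = λ e f → mk≋ λ i → trans (coeff-≡ e i) (coeff-≡ f i)
    }
  }

open Setoid ≋-setoid using () renaming (refl to ≋-refl; sym to ≋-sym)
module ≋-Reasoning = Relation.Binary.Reasoning.Setoid ≋-setoid

∷-cong : ∀ a {p q} → p ≋ q → (a ∷ p) ≋ (a ∷ q)
∷-cong a e = mk≋ λ { zero → refl ; (suc i) → coeff-≡ e i }

+ₚ-cong : ∀ {p p′ q q′} → p ≋ p′ → q ≋ q′ → (p +ₚ q) ≋ (p′ +ₚ q′)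
+ₚ-cong {p} {p′} {q} {q′} e f = mk≋ λ i → begin
  coeff (p +ₚ q) i         ≡⟨ coeff-+ₚ p q i ⟩
  coeff p i + coeff q i    ≡⟨ cong₂ _+_ (coeff-≡ e i) (coeff-≡ f i) ⟩
  coeff p′ i + coeff q′ i  ≡⟨ coeff-+ₚ p′ q′ i ⟨
  coeff (p′ +ₚ q′) i       ∎
  where open ≡-Reasoning

·ₚ-cong : ∀ c {p q} → p ≋ q → (c ·ₚ p) ≋ (c ·ₚ q)
·ₚ-cong c {p} {q} e = mk≋ λ i → begin
  coeff (c ·ₚ p) i   ≡⟨ coeff-·ₚ c p i ⟩
  c * coeff p i      ≡⟨ cong (c *_) (coeff-≡ e i) ⟩
  c * coeff q i      ≡⟨ coeff-·ₚ c q i ⟨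
  coeff (c ·ₚ q) i   ∎
  where open ≡-Reasoning

·ₚ-zeroˡ : ∀ p → (0ℤ ·ₚ p) ≋ []
·ₚ-zeroˡ p = mk≋ λ i → trans (coeff-·ₚ 0ℤ p i) (*-zeroˡ (coeff p i))

*ₚ-congʳ : ∀ p {q q′} → q ≋ q′ → (p *ₚ q) ≋ (p *ₚ q′)
*ₚ-congʳ []      e = ≋-refl
*ₚ-congʳ (a ∷ p) e = +ₚ-cong (·ₚ-cong a e) (∷-cong 0ℤ (*ₚ-congʳ p e))

*ₚ-assoc : ∀ p q r → ((p *ₚ q) *ₚ r) ≋ (p *ₚ (q *ₚ r))
*ₚ-assoc []      q r = ≋-refl
*ₚ-assoc (a ∷ p) q r = begin
  ((a ·ₚ q) +ₚ (0ℤ ∷ (p *ₚ q))) *ₚ r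
    ≡⟨ *ₚ-distribʳ (a ·ₚ q) (0ℤ ∷ (p *ₚ q)) r ⟩
  ((a ·ₚ q) *ₚ r) +ₚ ((0ℤ ·ₚ r) +ₚ (0ℤ ∷ ((p *ₚ q) *ₚ r)))
    ≡⟨ cong (_+ₚ ((0ℤ ·ₚ r) +ₚ (0ℤ ∷ ((p *ₚ q) *ₚ r)))) (·ₚ-*ₚ-assoc a q r) ⟩
  (a ·ₚ (q *ₚ r)) +ₚ ((0ℤ ·ₚ r) +ₚ (0ℤ ∷ ((p *ₚ q) *ₚ r)))
    ≈⟨ +ₚ-cong ≋-refl (+ₚ-cong (·ₚ-zeroˡ r) (∷-cong 0ℤ (*ₚ-assoc p q r))) ⟩
  (a ∷ p) *ₚ (q *ₚ r) ∎
  where open ≋-Reasoning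

substitute-quotient : ∀ P Q F R₁ T₁ R₂ T →
  F ≈ₚ (R₁ +ₚ (P *ₚ T₁)) → T₁ ≈ₚ (R₂ +ₚ (Q *ₚ T)) →
  F ≈ₚ ((R₁ +ₚ (P *ₚ R₂)) +ₚ ((P *ₚ Q) *ₚ T))
substitute-quotient P Q F R₁ T₁ R₂ T F≈ T₁≈ = coeff-≡ (begin
  F                                            ≈⟨ mk≋ F≈ ⟩
  R₁ +ₚ (P *ₚ T₁)                              ≈⟨ +ₚ-cong (≋-refl {R₁}) (*ₚ-congʳ P (mk≋ T₁≈)) ⟩
  R₁ +ₚ (P *ₚ (R₂ +ₚ (Q *ₚ T)))                ≡⟨ cong (R₁ +ₚ_) (*ₚ-distribˡ P R₂ (Q *ₚ T)) ⟩
  R₁ +ₚ ((P *ₚ R₂) +ₚ (P *ₚ (Q *ₚ T)))         ≈⟨ +ₚ-cong (≋-refl {R₁}) (+ₚ-cong (≋-refl {P *ₚ R₂}) (≋-sym (*ₚ-assoc P Q T))) ⟩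
  R₁ +ₚ ((P *ₚ R₂) +ₚ ((P *ₚ Q) *ₚ T))         ≡⟨ +ₚ-assoc R₁ (P *ₚ R₂) ((P *ₚ Q) *ₚ T) ⟨
  (R₁ +ₚ (P *ₚ R₂)) +ₚ ((P *ₚ Q) *ₚ T)         ∎)
  where open ≋-Reasoning

-- Both summand sets are included because _+ₚ_ copies the tail of the longer list.
_⊞_ : List ℤ → List ℤ → List ℤ
𝓐 ⊞ 𝓑 = cartesianProductWith _+_ 𝓐 𝓑 ++ (𝓐 ++ 𝓑)

productDigits : Poly → List ℤ → List ℤ
productDigits []      𝓜 = []
productDigits (a ∷ p) 𝓜 = map (a *_) 𝓜 ⊞ (0ℤ ∷ productDigits p 𝓜)

All-+ₚ : ∀ {𝓐 𝓑 p q} → All (_∈ 𝓐) p → All (_∈ 𝓑) q → All (_∈ 𝓐 ⊞ 𝓑) (p +ₚ q)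
All-+ₚ {𝓐} {𝓑} []       q∈ = All.map (λ b∈ → ∈-++⁺ʳ (cartesianProductWith _+_ 𝓐 𝓑) (∈-++⁺ʳ 𝓐 b∈)) q∈
All-+ₚ {𝓐} {𝓑} (a∈ ∷ p∈) [] =
  All.map (λ c∈ → ∈-++⁺ʳ (cartesianProductWith _+_ 𝓐 𝓑) (∈-++⁺ˡ c∈)) (a∈ ∷ p∈)
All-+ₚ (a∈ ∷ p∈) (b∈ ∷ q∈) = ∈-++⁺ˡ (∈-cartesianProductWith⁺ _+_ a∈ b∈) ∷ All-+ₚ p∈ q∈

All-·ₚ : ∀ {𝓐} c {p} → All (_∈ 𝓐) p → All (_∈ map (c *_) 𝓐) (c ·ₚ p)
All-·ₚ c []        = []
All-·ₚ c (a∈ ∷ p∈) = ∈-map⁺ (c *_) a∈ ∷ All-·ₚ c p∈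

All-*ₚ : ∀ {𝓜} P {R} → All (_∈ 𝓜) R → All (_∈ productDigits P 𝓜) (P *ₚ R)
All-*ₚ []      R∈ = []
All-*ₚ (a ∷ p) R∈ = All-+ₚ (All-·ₚ a R∈) (here refl ∷ All.map there (All-*ₚ p R∈))

InDigitPoly⇒All : ∀ {𝓐} p → InDigitPoly 𝓐 p → All (_∈ 𝓐) p
InDigitPoly⇒All (d ∷ ds) p∈ = p∈

InDigitPoly-+ₚ : ∀ {𝓐 𝓑} p q → InDigitPoly 𝓐 p → All (_∈ 𝓑) q → InDigitPoly (𝓐 ⊞ 𝓑) (p +ₚ q)
InDigitPoly-+ₚ (d ∷ ds) []      p∈ q∈ = All-+ₚ p∈ q∈
InDigitPoly-+ₚ (d ∷ ds) (b ∷ q) p∈ q∈ = All-+ₚ p∈ q∈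

lemma1 : (P Q : Poly) (𝓛 𝓜 : List ℤ) →
           Covers 𝓛 P → Covers 𝓜 Q →
           Σ (List ℤ) (λ 𝓝 → Covers 𝓝 (P *ₚ Q))
lemma1 P Q 𝓛 𝓜 coversP coversQ = 𝓛 ⊞ productDigits P 𝓜 , covers
  where
  covers : Covers (𝓛 ⊞ productDigits P 𝓜) (P *ₚ Q)
  covers F with coversP F
  ... | R₁ , T₁ , R₁∈ , F≈ with coversQ T₁
  ... | R₂ , T , R₂∈ , T₁≈ =
    R₁ +ₚ (P *ₚ R₂) , T ,
    InDigitPoly-+ₚ R₁ (P *ₚ R₂) R₁∈ (All-*ₚ P (InDigitPoly⇒All R₂ R₂∈)) ,
    substitute-quotient P Q F R₁ T₁ R₂ T F≈ T₁≈
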